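{- For all $\hat f,\hat g\in\widehat{\mathcal O}_\theta$, $$|\hat f-\hat g|_\theta\le\theta^2\max\{|\hat f|_\theta,|\hat g|_\theta\},$$ where for $\hat h\in\widehat{\mathcal O}_\theta$, $|\hat h|_\theta:=\max_{(h_i)\in\hat h}\limsup_i|h_i|_\theta$, the maximum being over all Cauchy sequences $(h_i)$ representing $\hat h$.
   Context: $\theta>1$ is a real quadratic unit with $N(\theta)=-1$, so $\theta^2=a\theta+1$ with an integer $a\ge1$; $K=\mathbb Q(\theta)\subset\mathbb R$, $\mathcal O_K$ its ring of integers. A greedy polynomial is a finite sum $\sum_{i=m}^M b_i\theta^i$ with $b_i\in\{0,\dots,a\}$ such that $b_i=a$ implies $b_{i-1}=0$; every nonzero $\alpha\in\mathcal O_K$ is uniquely $\alpha=\pm\sum_{i=m}^Mb_i\theta^i$ greedy with $b_m\ne0$, and $|\alpha|_\theta:=\theta^{ -m}$, $|0|_\theta=0$. Let $\mathcal R_\theta$ be the ring (componentwise operations) of sequences $(f_n)$ in $\mathcal O_K$ that are Cauchy for $|\cdot|_\theta$ (for each $\varepsilon>0$ there is $N$ with $|f_i-f_j|_\theta<\varepsilon$ for $i,j\ge N$), $\mathcal M_\theta$ the ideal of those with $|f_n|_\theta\to0$, and $\widehat{\mathcal O}_\theta=\mathcal R_\theta/\mathcal M_\theta$. -}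

module Defs where

open import Data.Nat as ℕ using (ℕ; zero; suc)
open import Data.Integer as ℤ using (ℤ; +_; -[1+_]; _+_; _*_; -_; _-_)
open import Data.Product using (Σ; ∃; _×_; _,_)
open import Data.Sum using (_⊎_)
open import Data.List using (List; []; _∷_)
open import Relation.Binary.PropositionalEquality using (_≡_; _≢_)
open import Data.Unit using (⊤)

-- The parameter a ≥ 1 fixes θ > 1 with θ² = aθ + 1.
-- An element of ℤ[θ] is represented by a pair (x , y) meaning x + yθ.
-- (Since θ is a unit and every element of O_K has a greedy expansion,
--  O_K = ℤ[θ] = ℤ[θ,θ⁻¹] in the paper's setting.)
record Zθ : Set where
  constructor ⟨_,_⟩
  field
    re : ℤ
    im : ℤ

open Zθ public

zθ : Zθ
zθ = ⟨ + 0 , + 0 ⟩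

oneθ : Zθ
oneθ = ⟨ + 1 , + 0 ⟩

addθ : Zθ → Zθ → Zθ
addθ ⟨ x , y ⟩ ⟨ u , v ⟩ = ⟨ x + u , y + v ⟩

negθ : Zθ → Zθ
negθ ⟨ x , y ⟩ = ⟨ - x , - y ⟩

subθ : Zθ → Zθ → Zθ
subθ α β = addθ α (negθ β)

-- (x + yθ)(u + vθ) = (xu + yv) + (xv + yu + a·yv)θ, using θ² = aθ + 1
mulθ : ℕ → Zθ → Zθ → Zθ
mulθ a ⟨ x , y ⟩ ⟨ u , v ⟩ = ⟨ x * u + y * v , x * v + y * u + (+ a) * (y * v) ⟩

-- θ itself and θ⁻¹ = θ - a
θel : Zθ
θel = ⟨ + 0 , + 1 ⟩

θinv : ℕ → Zθ
θinv a = ⟨ - (+ a) , + 1 ⟩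

θpowℕ : ℕ → ℕ → Zθ
θpowℕ a zero = oneθ
θpowℕ a (suc n) = mulθ a θel (θpowℕ a n)

θinvpowℕ : ℕ → ℕ → Zθ
θinvpowℕ a zero = oneθ
θinvpowℕ a (suc n) = mulθ a (θinv a) (θinvpowℕ a n)

θpow : ℕ → ℤ → Zθ
θpow a (+ n) = θpowℕ a n
θpow a -[1+ n ] = θinvpowℕ a (suc n)

digitSum : ℕ → ℤ → List ℕ → Zθ
digitSum a m [] = zθ
digitSum a m (b ∷ bs) = addθ (mulθ a (⟨ + b , + 0 ⟩) (θpow a m)) (digitSum a (m + + 1) bs)

AllDigits : ℕ → List ℕ → Set
AllDigits a [] = ⊤
AllDigits a (b ∷ bs) = (b ℕ.≤ a) × AllDigits a bs

-- greedy condition on consecutive digits: b_i = a ⇒ b_{i-1} = 0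
-- (list is in increasing index order; below the lowest index digits are 0)
GreedyCond : ℕ → List ℕ → Set
GreedyCond a [] = ⊤
GreedyCond a (b ∷ []) = ⊤
GreedyCond a (b ∷ c ∷ bs) = (c ≡ a → b ≡ 0) × GreedyCond a (c ∷ bs)

GreedyExpansion : ℕ → Zθ → ℤ → Set
GreedyExpansion a α m =
  Σ ℕ λ b → Σ (List ℕ) λ bs →
    (b ≢ 0) × AllDigits a (b ∷ bs) × GreedyCond a (b ∷ bs) ×
    ((α ≡ digitSum a m (b ∷ bs)) ⊎ (α ≡ negθ (digitSum a m (b ∷ bs))))

-- |α|_θ ≤ θ^{-e}   (|α|_θ = θ^{-m} where m is the lowest index, |0|_θ = 0)
AbsLE : ℕ → Zθ → ℤ → Set
AbsLE a α e = (α ≡ zθ) ⊎ (Σ ℤ λ m → GreedyExpansion a α m × (e ℤ.≤ m))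

Seq : Set
Seq = ℕ → Zθ

-- Cauchy for |·|_θ: for each ε = θ^{-k} ... ; |x|_θ < θ^{-k} ⇔ |x|_θ ≤ θ^{-(k+1)}
IsCauchy : ℕ → Seq → Set
IsCauchy a f = (k : ℕ) → Σ ℕ λ N → (i j : ℕ) → N ℕ.≤ i → N ℕ.≤ j →
  AbsLE a (subθ (f i) (f j)) (+ suc k)

IsNull : ℕ → Seq → Set
IsNull a f = (k : ℕ) → Σ ℕ λ N → (i : ℕ) → N ℕ.≤ i → AbsLE a (f i) (+ k)

subSeq : Seq → Seq → Seq
subSeq f g i = subθ (f i) (g i)

-- f' represents the same class as f in R_θ / M_θ
Represents : ℕ → Seq → Seq → Set
Represents a f' f = IsCauchy a f' × IsNull a (subSeq f' f)

-- |f̂|_θ ≤ θ^{-e} where f̂ is the class of f: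
-- every representative f' has limsup_i |f'_i|_θ ≤ θ^{-e}, i.e. (values being
-- in {0} ∪ θ^ℤ) eventually |f'_i|_θ ≤ θ^{-e}.
NormLE : ℕ → Seq → ℤ → Set
NormLE a f e = (f' : Seq) → Represents a f' f →
  Σ ℕ λ N → (i : ℕ) → N ℕ.≤ i → AbsLE a (f' i) e

{-# OPTIONS --safe #-}
-- Let σ = conj be the Galois conjugation of ℤ[θ] (θ ↦ a − θ = −θ⁻¹). The conjugates of the sums
-- X = Σ_{i ≥ 0} bᵢθⁱ with digits 0 ≤ bᵢ ≤ a lie in the window (−1, θ), and conversely every
-- X ≥ 0 with σX in the window is such a sum with greedy digits: the lowest digit is read off
-- the position of σX, and (X − b₀)/θ is again in the window. If u = ±θᵉX and v = ±θᵉY, then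
-- X ∓ Y is, up to sign, nonnegative with conjugate in (−θ², θ³), so θ²(X ∓ Y) lies in the
-- window; hence u − v is a greedy sum from the index e − 2, i.e. |u − v|_θ ≤ θ^(2−e). Given a
-- representative F of f̂ − ĝ, the sequence F + g represents f̂, and F = (F + g) − g.
module Submission where

open import Defs
open import Data.Nat using (ℕ; _≤_)
open import Data.Integer using (ℤ; _-_; +_)

open import Data.Nat as ℕ using (zero; suc; z≤n; s≤s; _⊔_)
import Data.Nat.Properties as ℕ
open import Data.Integer as ℤ using (+0; +[1+_]; -[1+_]; _+_; _*_; -_)
import Data.Integer.Properties as ℤ
import Data.Nat.Tactic.RingSolver as ℕ-Ring
open import Data.Integer.Tactic.RingSolver using (solve-∀)
open import Data.List using (List; []; _∷_; _++_; replicate)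
open import Data.Product using (Σ; _×_; _,_; proj₁; proj₂)
open import Data.Sum using (_⊎_; inj₁; inj₂; reduce)
open import Data.Empty using (⊥; ⊥-elim)
open import Relation.Nullary using (¬_; Dec; yes; no)
open import Relation.Binary.PropositionalEquality

coords : ∀ {x y u v} → x ≡ u → y ≡ v → ⟨ x , y ⟩ ≡ ⟨ u , v ⟩
coords = cong₂ ⟨_,_⟩

module GreedyExpansions (a-1 : ℕ) where

  a : ℕ
  a = suc a-1

  A : ℤ
  A = + a

  infixl 6 _⊕_ _⊖_
  infixr 8 ⊝_ θ·_ θ⁻¹·_

  _⊕_ : Zθ → Zθ → Zθ
  _⊕_ = addθ

  ⊝_ : Zθ → Zθ
  ⊝_ = negθ

  _⊖_ : Zθ → Zθ → Zθ
  _⊖_ = subθ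

  ⌜_⌝ : ℕ → Zθ
  ⌜ n ⌝ = ⟨ + n , + 0 ⟩

  θ·_ : Zθ → Zθ
  θ· ⟨ x , y ⟩ = ⟨ y , x + A * y ⟩

  θ⁻¹·_ : Zθ → Zθ
  θ⁻¹· ⟨ x , y ⟩ = ⟨ y - A * x , x ⟩

  conj : Zθ → Zθ
  conj ⟨ x , y ⟩ = ⟨ x + A * y , - y ⟩

  θ·θ⁻¹· : ∀ v → θ· θ⁻¹· v ≡ v
  θ·θ⁻¹· ⟨ x , y ⟩ = coords refl (ring x y A)
    where ring : ∀ x y A → (y - A * x) + A * x ≡ y
          ring = solve-∀

  θ⁻¹·θ· : ∀ v → θ⁻¹· θ· v ≡ v
  θ⁻¹·θ· ⟨ x , y ⟩ = coords (ring x y A) refl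
    where ring : ∀ x y A → (x + A * y) - A * y ≡ x
          ring = solve-∀

  θ·-⊕ : ∀ v w → θ· (v ⊕ w) ≡ θ· v ⊕ θ· w
  θ·-⊕ ⟨ x , y ⟩ ⟨ u , w ⟩ = coords refl (ring x y u w A)
    where ring : ∀ x y u w A → (x + u) + A * (y + w) ≡ (x + A * y) + (u + A * w)
          ring = solve-∀

  θ⁻¹·-⊕ : ∀ v w → θ⁻¹· (v ⊕ w) ≡ θ⁻¹· v ⊕ θ⁻¹· w
  θ⁻¹·-⊕ ⟨ x , y ⟩ ⟨ u , w ⟩ = coords (ring x y u w A) refl
    where ring : ∀ x y u w A → (y + w) - A * (x + u) ≡ (y - A * x) + (w - A * u)
          ring = solve-∀

  θ·-⊝ : ∀ v → θ· ⊝ v ≡ ⊝ θ· v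
  θ·-⊝ ⟨ x , y ⟩ = coords refl (ring x y A)
    where ring : ∀ x y A → - x + A * - y ≡ - (x + A * y)
          ring = solve-∀

  θ⁻¹·-⊝ : ∀ v → θ⁻¹· ⊝ v ≡ ⊝ θ⁻¹· v
  θ⁻¹·-⊝ ⟨ x , y ⟩ = coords (ring x y A) refl
    where ring : ∀ x y A → - y - A * - x ≡ - (y - A * x)
          ring = solve-∀

  θ·-0 : θ· zθ ≡ zθ
  θ·-0 = coords refl (trans (ℤ.+-identityˡ _) (ℤ.*-zeroʳ A))

  θ⁻¹·-0 : θ⁻¹· zθ ≡ zθ
  θ⁻¹·-0 = coords (trans (ℤ.+-identityˡ _) (cong -_ (ℤ.*-zeroʳ A))) refl

  θ·≡0⇒≡0 : ∀ {v} → θ· v ≡ zθ → v ≡ zθ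
  θ·≡0⇒≡0 {v} θv≡0 = trans (sym (θ⁻¹·θ· v)) (trans (cong θ⁻¹·_ θv≡0) θ⁻¹·-0)

  ⊕-identityˡ : ∀ v → zθ ⊕ v ≡ v
  ⊕-identityˡ ⟨ x , y ⟩ = coords (ℤ.+-identityˡ x) (ℤ.+-identityˡ y)

  ⊕-identityʳ : ∀ v → v ⊕ zθ ≡ v
  ⊕-identityʳ ⟨ x , y ⟩ = coords (ℤ.+-identityʳ x) (ℤ.+-identityʳ y)

  ⊖-self : ∀ v → v ⊖ v ≡ zθ
  ⊖-self ⟨ x , y ⟩ = coords (ℤ.+-inverseʳ x) (ℤ.+-inverseʳ y)

  ⊝-involutive : ∀ v → ⊝ ⊝ v ≡ v
  ⊝-involutive ⟨ x , y ⟩ = coords (ℤ.neg-involutive x) (ℤ.neg-involutive y)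

  ⊝-⊖ : ∀ v w → ⊝ (v ⊖ w) ≡ w ⊖ v
  ⊝-⊖ ⟨ x , y ⟩ ⟨ u , w ⟩ = coords (ring x u) (ring y w)
    where ring : ∀ x u → - (x + - u) ≡ u + - x
          ring = solve-∀

  ⊖-⌜0⌝ : ∀ v → v ⊖ ⌜ 0 ⌝ ≡ v
  ⊖-⌜0⌝ ⟨ x , y ⟩ = coords (ℤ.+-identityʳ x) (ℤ.+-identityʳ y)

  ⊝-⊕ : ∀ v w → ⊝ (v ⊕ w) ≡ ⊝ v ⊕ ⊝ w
  ⊝-⊕ ⟨ x , y ⟩ ⟨ u , w ⟩ = coords (ℤ.neg-distrib-+ x u) (ℤ.neg-distrib-+ y w)

  ⊕-⊖-⊕ : ∀ v w v′ w′ → (v ⊕ w) ⊖ (v′ ⊕ w′) ≡ (v ⊖ v′) ⊖ (w′ ⊖ w)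
  ⊕-⊖-⊕ ⟨ x , y ⟩ ⟨ u , w ⟩ ⟨ x′ , y′ ⟩ ⟨ u′ , w′ ⟩ = coords (ring x u x′ u′) (ring y w y′ w′)
    where ring : ∀ x u x′ u′ → (x + u) + - (x′ + u′) ≡ (x + - x′) + - (u′ + - u)
          ring = solve-∀

  ⊖-⊖ : ∀ v w z → v ⊖ (w ⊖ z) ≡ (v ⊕ z) ⊖ w
  ⊖-⊖ ⟨ x , y ⟩ ⟨ u , w ⟩ ⟨ s , t ⟩ = coords (ring x u s) (ring y w t)
    where ring : ∀ x u s → x + - (u + - s) ≡ (x + s) + - u
          ring = solve-∀

  ⊕-⊖-cancel : ∀ v w → (v ⊕ w) ⊖ w ≡ v
  ⊕-⊖-cancel ⟨ x , y ⟩ ⟨ u , w ⟩ = coords (ring x u) (ring y w)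
    where ring : ∀ x u → (x + u) + - u ≡ x
          ring = solve-∀

  -- The order of ℤ[θ] ⊂ ℝ

  infixr 8 θ^_·_

  θ^_·_ : ℕ → Zθ → Zθ
  θ^ zero · v = v
  θ^ suc n · v = θ· θ^ n · v

  θ^-θ· : ∀ n v → θ^ n · θ· v ≡ θ· θ^ n · v
  θ^-θ· zero v = refl
  θ^-θ· (suc n) v = cong θ·_ (θ^-θ· n v)

  θ^-⊕ : ∀ n v w → θ^ n · (v ⊕ w) ≡ θ^ n · v ⊕ θ^ n · w
  θ^-⊕ zero v w = refl
  θ^-⊕ (suc n) v w = trans (cong θ·_ (θ^-⊕ n v w)) (θ·-⊕ (θ^ n · v) (θ^ n · w))

  θ^-+ : ∀ m n v → θ^ (m ℕ.+ n) · v ≡ θ^ m · θ^ n · v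
  θ^-+ zero n v = refl
  θ^-+ (suc m) n v = cong θ·_ (θ^-+ m n v)

  θ^-0 : ∀ n → θ^ n · zθ ≡ zθ
  θ^-0 zero = refl
  θ^-0 (suc n) = trans (cong θ·_ (θ^-0 n)) θ·-0

  -- Positivity of x + yθ ∈ ℝ is witnessed by a power θⁿ(x + yθ) with natural coordinates.
  data Natural⁺ : Zθ → Set where
    natural⁺ : ∀ p q → 0 ℕ.< p ℕ.+ q → Natural⁺ ⟨ + p , + q ⟩

  Positive : Zθ → Set
  Positive v = Σ ℕ λ n → Natural⁺ (θ^ n · v)

  NonNegative : Zθ → Set
  NonNegative v = Positive v ⊎ v ≡ zθ

  Natural⁺-θ· : ∀ {v} → Natural⁺ v → Natural⁺ (θ· v)
  Natural⁺-θ· (natural⁺ p q p+q>0) =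
    subst Natural⁺ (coords refl (cong (_+_ (+ p)) (ℤ.pos-* a q)))
      (natural⁺ q (p ℕ.+ a ℕ.* q) (ℕ.<-≤-trans p+q>0 p+q≤q+[p+aq]))
    where
    p+q≤q+[p+aq] : p ℕ.+ q ℕ.≤ q ℕ.+ (p ℕ.+ a ℕ.* q)
    p+q≤q+[p+aq] = ℕ.≤-trans (ℕ.≤-reflexive (ℕ.+-comm p q)) (ℕ.+-monoʳ-≤ q (ℕ.m≤m+n p _))

  Natural⁺-θ^ : ∀ n {v} → Natural⁺ v → Natural⁺ (θ^ n · v)
  Natural⁺-θ^ zero nv = nv
  Natural⁺-θ^ (suc n) nv = Natural⁺-θ· (Natural⁺-θ^ n nv)

  Natural⁺-⊕ : ∀ {v w} → Natural⁺ v → Natural⁺ w → Natural⁺ (v ⊕ w)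
  Natural⁺-⊕ (natural⁺ p q h) (natural⁺ p′ q′ _) =
    natural⁺ (p ℕ.+ p′) (q ℕ.+ q′) (ℕ.<-≤-trans h (ℕ.+-mono-≤ (ℕ.m≤m+n p p′) (ℕ.m≤m+n q q′)))

  ¬Natural⁺-0 : ¬ Natural⁺ zθ
  ¬Natural⁺-0 (natural⁺ zero zero ())

  Natural⇒Positive : ∀ p q → 0 ℕ.< p ℕ.+ q → Positive ⟨ + p , + q ⟩
  Natural⇒Positive p q h = 0 , natural⁺ p q h

  Positive-⊕ : ∀ {v w} → Positive v → Positive w → Positive (v ⊕ w)
  Positive-⊕ {v} {w} (m , θᵐv) (n , θⁿw) = n ℕ.+ m ,
    subst Natural⁺ (sym θ^[n+m]-⊕) (Natural⁺-⊕ (Natural⁺-θ^ n θᵐv) (Natural⁺-θ^ m θⁿw))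
    where
    θ^[n+m]-⊕ : θ^ (n ℕ.+ m) · (v ⊕ w) ≡ θ^ n · θ^ m · v ⊕ θ^ m · θ^ n · w
    θ^[n+m]-⊕ = trans (θ^-⊕ (n ℕ.+ m) v w)
      (cong₂ _⊕_ (θ^-+ n m v) (trans (cong (λ k → θ^ k · w) (ℕ.+-comm n m)) (θ^-+ m n w)))

  Positive-θ· : ∀ {v} → Positive v → Positive (θ· v)
  Positive-θ· {v} (n , θⁿv) = n , subst Natural⁺ (sym (θ^-θ· n v)) (Natural⁺-θ· θⁿv)

  Positive-θ·⁻ : ∀ {v} → Positive (θ· v) → Positive v
  Positive-θ·⁻ {v} (n , θⁿθv) = suc n , subst Natural⁺ (θ^-θ· n v) θⁿθv

  Positive-θ⁻¹· : ∀ {v} → Positive v → Positive (θ⁻¹· v)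
  Positive-θ⁻¹· {v} pv = Positive-θ·⁻ (subst Positive (sym (θ·θ⁻¹· v)) pv)

  ¬Positive-0 : ¬ Positive zθ
  ¬Positive-0 (n , θⁿ0) = ¬Natural⁺-0 (subst Natural⁺ (θ^-0 n) θⁿ0)

  Positive⇒¬NonNegative-⊝ : ∀ {v} → Positive v → ¬ NonNegative (⊝ v)
  Positive⇒¬NonNegative-⊝ {v} pv (inj₁ p-v) = ¬Positive-0 (subst Positive (⊖-self v) (Positive-⊕ pv p-v))
  Positive⇒¬NonNegative-⊝ {v} pv (inj₂ -v≡0) =
    ¬Positive-0 (subst Positive (trans (sym (⊝-involutive v)) (cong ⊝_ -v≡0)) pv)

  Positive-⊕-NonNegative : ∀ {v w} → Positive v → NonNegative w → Positive (v ⊕ w)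
  Positive-⊕-NonNegative pv (inj₁ pw) = Positive-⊕ pv pw
  Positive-⊕-NonNegative {v} pv (inj₂ refl) = subst Positive (sym (⊕-identityʳ v)) pv

  NonNegative-⊕-Positive : ∀ {v w} → NonNegative v → Positive w → Positive (v ⊕ w)
  NonNegative-⊕-Positive (inj₁ pv) pw = Positive-⊕ pv pw
  NonNegative-⊕-Positive {w = w} (inj₂ refl) pw = subst Positive (sym (⊕-identityˡ w)) pw

  NonNegative-⊕ : ∀ {v w} → NonNegative v → NonNegative w → NonNegative (v ⊕ w)
  NonNegative-⊕ (inj₁ pv) nw = inj₁ (Positive-⊕-NonNegative pv nw)
  NonNegative-⊕ {w = w} (inj₂ refl) nw = subst NonNegative (sym (⊕-identityˡ w)) nw

  NonNegative-θ· : ∀ {v} → NonNegative v → NonNegative (θ· v)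
  NonNegative-θ· (inj₁ pv) = inj₁ (Positive-θ· pv)
  NonNegative-θ· (inj₂ refl) = inj₂ θ·-0

  NonNegative-θ⁻¹· : ∀ {v} → NonNegative v → NonNegative (θ⁻¹· v)
  NonNegative-θ⁻¹· (inj₁ pv) = inj₁ (Positive-θ⁻¹· pv)
  NonNegative-θ⁻¹· (inj₂ refl) = inj₂ θ⁻¹·-0

  NonNegative-θ·⁻ : ∀ {v} → NonNegative (θ· v) → NonNegative v
  NonNegative-θ·⁻ (inj₁ pθv) = inj₁ (Positive-θ·⁻ pθv)
  NonNegative-θ·⁻ (inj₂ θv≡0) = inj₂ (θ·≡0⇒≡0 θv≡0)

  NonNegative-natural : ∀ p q → NonNegative ⟨ + p , + q ⟩
  NonNegative-natural zero zero = inj₂ refl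
  NonNegative-natural zero (suc q) = inj₁ (Natural⇒Positive 0 (suc q) (s≤s z≤n))
  NonNegative-natural (suc p) q = inj₁ (Natural⇒Positive (suc p) q (s≤s z≤n))

  NonNegative-∸ : ∀ {m n} → n ≤ m → NonNegative ⟨ + m - + n , +0 ⟩
  NonNegative-∸ {m} {n} n≤m = subst (λ z → NonNegative ⟨ z , +0 ⟩)
    (sym (trans (ℤ.[+m]-[+n]≡m⊖n m n) (ℤ.⊖-≥ n≤m))) (NonNegative-natural (m ℕ.∸ n) 0)

  data Sign (v : Zθ) : Set where
    positive : Positive v → Sign v
    zero : v ≡ zθ → Sign v
    negative : Positive (⊝ v) → Sign v

  Sign-⊝ : ∀ {v} → Sign v → Sign (⊝ v)
  Sign-⊝ {v} (positive pv) = negative (subst Positive (sym (⊝-involutive v)) pv)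
  Sign-⊝ (zero refl) = zero refl
  Sign-⊝ (negative p-v) = positive p-v

  Sign-θ·⁻ : ∀ {v} → Sign (θ· v) → Sign v
  Sign-θ·⁻ (positive pθv) = positive (Positive-θ·⁻ pθv)
  Sign-θ·⁻ (zero θv≡0) = zero (θ·≡0⇒≡0 θv≡0)
  Sign-θ·⁻ {v} (negative p-θv) = negative (Positive-θ·⁻ (subst Positive (sym (θ·-⊝ v)) p-θv))

  -- θ·(x + yθ) = y + (x + a y)θ: for coordinates of mixed signs either both new
  -- coordinates are ≤ 0, or the signs are still mixed and the size has dropped.
  sign-mixed : ∀ n p q → p ℕ.+ q ℕ.< n → Sign ⟨ +[1+ p ] , -[1+ q ] ⟩
  sign-mixed (suc n) p q p+q<1+n = Sign-θ·⁻ (sign-θ· (p ℕ.≤? m))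
    where
    m = q ℕ.+ a-1 ℕ.* suc q   -- a (1 + q) = 1 + m
    θ·v≡ : θ· ⟨ +[1+ p ] , -[1+ q ] ⟩ ≡ ⟨ -[1+ q ] , p ℤ.⊖ m ⟩
    θ·v≡ = coords refl (ℤ.[1+m]⊖[1+n]≡m⊖n p m)
    sign-θ· : Dec (p ℕ.≤ m) → Sign (θ· ⟨ +[1+ p ] , -[1+ q ] ⟩)
    sign-θ· (yes p≤m) =
      negative (subst Positive (sym -θ·v≡) (Natural⇒Positive (suc q) (m ℕ.∸ p) (s≤s z≤n)))
      where
      -θ·v≡ : ⊝ θ· ⟨ +[1+ p ] , -[1+ q ] ⟩ ≡ ⟨ +[1+ q ] , + (m ℕ.∸ p) ⟩
      -θ·v≡ = trans (cong ⊝_ θ·v≡)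
        (coords refl (trans (cong -_ (ℤ.⊖-≤ p≤m)) (ℤ.neg-involutive _)))
    sign-θ· (no p≰m) = subst Sign (sym θ·v≡′) (Sign-⊝ (sign-mixed n q r q+r<n))
      where
      r = p ℕ.∸ suc m
      m<p = ℕ.≰⇒> p≰m
      p∸m≡1+r : p ℕ.∸ m ≡ suc r
      p∸m≡1+r = ℕ.+-∸-assoc 1 m<p
      θ·v≡′ : θ· ⟨ +[1+ p ] , -[1+ q ] ⟩ ≡ ⟨ -[1+ q ] , +[1+ r ] ⟩
      θ·v≡′ = trans θ·v≡ (coords refl (trans (ℤ.⊖-≥ (ℕ.<⇒≤ m<p)) (cong +_ p∸m≡1+r)))
      q+r<n : q ℕ.+ r ℕ.< n
      q+r<n = ℕ.<-≤-trans (ℕ.+-monoʳ-< q (ℕ.<-≤-trans (ℕ.≤-reflexive (sym p∸m≡1+r)) (ℕ.m∸n≤m p m)))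
                (ℕ.≤-trans (ℕ.≤-reflexive (ℕ.+-comm q p)) (ℕ.≤-pred p+q<1+n))

  sign : ∀ v → Sign v
  sign ⟨ +0 , +0 ⟩ = zero refl
  sign ⟨ +0 , +[1+ q ] ⟩ = positive (Natural⇒Positive 0 (suc q) (s≤s z≤n))
  sign ⟨ +[1+ p ] , + q ⟩ = positive (Natural⇒Positive (suc p) q (s≤s z≤n))
  sign ⟨ +0 , -[1+ q ] ⟩ = negative (Natural⇒Positive 0 (suc q) (s≤s z≤n))
  sign ⟨ -[1+ p ] , +0 ⟩ = negative (Natural⇒Positive (suc p) 0 (s≤s z≤n))
  sign ⟨ -[1+ p ] , -[1+ q ] ⟩ = negative (Natural⇒Positive (suc p) (suc q) (s≤s z≤n))
  sign ⟨ +[1+ p ] , -[1+ q ] ⟩ = sign-mixed (suc (p ℕ.+ q)) p q ℕ.≤-refl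
  sign ⟨ -[1+ p ] , +[1+ q ] ⟩ = Sign-⊝ (sign-mixed (suc (p ℕ.+ q)) p q ℕ.≤-refl)

  infixr 8 θ⁻^_·_ θ^ℤ_·_

  θ⁻^_·_ : ℕ → Zθ → Zθ
  θ⁻^ zero · v = v
  θ⁻^ suc n · v = θ⁻¹· θ⁻^ n · v

  θ^ℤ_·_ : ℤ → Zθ → Zθ
  θ^ℤ + n · v = θ^ n · v
  θ^ℤ -[1+ n ] · v = θ⁻^ suc n · v

  θ⁻^-⊕ : ∀ n v w → θ⁻^ n · (v ⊕ w) ≡ θ⁻^ n · v ⊕ θ⁻^ n · w
  θ⁻^-⊕ zero v w = refl
  θ⁻^-⊕ (suc n) v w = trans (cong θ⁻¹·_ (θ⁻^-⊕ n v w)) (θ⁻¹·-⊕ (θ⁻^ n · v) (θ⁻^ n · w))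

  θ^-⊝ : ∀ n v → θ^ n · ⊝ v ≡ ⊝ θ^ n · v
  θ^-⊝ zero v = refl
  θ^-⊝ (suc n) v = trans (cong θ·_ (θ^-⊝ n v)) (θ·-⊝ (θ^ n · v))

  θ⁻^-⊝ : ∀ n v → θ⁻^ n · ⊝ v ≡ ⊝ θ⁻^ n · v
  θ⁻^-⊝ zero v = refl
  θ⁻^-⊝ (suc n) v = trans (cong θ⁻¹·_ (θ⁻^-⊝ n v)) (θ⁻¹·-⊝ (θ⁻^ n · v))

  θ^ℤ-⊕ : ∀ e v w → θ^ℤ e · (v ⊕ w) ≡ θ^ℤ e · v ⊕ θ^ℤ e · w
  θ^ℤ-⊕ (+ n) = θ^-⊕ n
  θ^ℤ-⊕ -[1+ n ] = θ⁻^-⊕ (suc n)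

  θ^ℤ-⊝ : ∀ e v → θ^ℤ e · ⊝ v ≡ ⊝ θ^ℤ e · v
  θ^ℤ-⊝ (+ n) = θ^-⊝ n
  θ^ℤ-⊝ -[1+ n ] = θ⁻^-⊝ (suc n)

  mulθ-θ : ∀ v → mulθ a θel v ≡ θ· v
  mulθ-θ ⟨ x , y ⟩ = coords (ring₁ x y) (ring₂ x y A)
    where
    ring₁ : ∀ x y → +0 * x + + 1 * y ≡ y
    ring₁ = solve-∀
    ring₂ : ∀ x y A → +0 * y + + 1 * x + A * (+ 1 * y) ≡ x + A * y
    ring₂ = solve-∀

  mulθ-θ⁻¹ : ∀ v → mulθ a (θinv a) v ≡ θ⁻¹· v
  mulθ-θ⁻¹ ⟨ x , y ⟩ = coords (ring₁ x y A) (ring₂ x y A)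
    where
    ring₁ : ∀ x y A → - A * x + + 1 * y ≡ y - A * x
    ring₁ = solve-∀
    ring₂ : ∀ x y A → - A * y + + 1 * x + A * (+ 1 * y) ≡ x
    ring₂ = solve-∀

  mulθ-⌜⌝-θ· : ∀ b v → mulθ a ⌜ b ⌝ (θ· v) ≡ θ· mulθ a ⌜ b ⌝ v
  mulθ-⌜⌝-θ· b ⟨ x , y ⟩ = coords (ring₁ (+ b) x y A) (ring₂ (+ b) x y A)
    where
    ring₁ : ∀ b x y A → b * y + +0 * (x + A * y) ≡ b * y + +0 * x + A * (+0 * y)
    ring₁ = solve-∀
    ring₂ : ∀ b x y A → b * (x + A * y) + +0 * y + A * (+0 * (x + A * y)) ≡
                        (b * x + +0 * y) + A * (b * y + +0 * x + A * (+0 * y))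
    ring₂ = solve-∀

  mulθ-⌜⌝-1 : ∀ b → mulθ a ⌜ b ⌝ oneθ ≡ ⌜ b ⌝
  mulθ-⌜⌝-1 b = coords (ring₁ (+ b)) (ring₂ (+ b) A)
    where
    ring₁ : ∀ b → b * + 1 + +0 * +0 ≡ b
    ring₁ = solve-∀
    ring₂ : ∀ b A → b * +0 + +0 * + 1 + A * (+0 * +0) ≡ +0
    ring₂ = solve-∀

  mulθ-0 : ∀ v → mulθ a ⌜ 0 ⌝ v ≡ zθ
  mulθ-0 ⟨ x , y ⟩ = coords (ring₁ x y) (ring₂ x y A)
    where
    ring₁ : ∀ x y → +0 * x + +0 * y ≡ +0
    ring₁ = solve-∀
    ring₂ : ∀ x y A → +0 * y + +0 * x + A * (+0 * y) ≡ +0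
    ring₂ = solve-∀

  θpow-suc : ∀ m → θpow a (m + + 1) ≡ θ· θpow a m
  θpow-suc (+ n) = trans (cong (θpowℕ a) (ℕ.+-comm n 1)) (mulθ-θ (θpowℕ a n))
  θpow-suc -[1+ zero ] = sym (trans (cong θ·_ (mulθ-θ⁻¹ oneθ)) (θ·θ⁻¹· oneθ))
  θpow-suc -[1+ suc n ] = sym (trans (cong θ·_ (mulθ-θ⁻¹ (θinvpowℕ a (suc n)))) (θ·θ⁻¹· _))

  digitSum-suc : ∀ m L → digitSum a (m + + 1) L ≡ θ· digitSum a m L
  digitSum-suc m [] = sym θ·-0
  digitSum-suc m (b ∷ L) = begin
    mulθ a ⌜ b ⌝ (θpow a (m + + 1)) ⊕ digitSum a (m + + 1 + + 1) L
      ≡⟨ cong₂ _⊕_ (trans (cong (mulθ a ⌜ b ⌝) (θpow-suc m)) (mulθ-⌜⌝-θ· b (θpow a m)))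
                   (digitSum-suc (m + + 1) L) ⟩
    θ· mulθ a ⌜ b ⌝ (θpow a m) ⊕ θ· digitSum a (m + + 1) L
      ≡⟨ θ·-⊕ (mulθ a ⌜ b ⌝ (θpow a m)) (digitSum a (m + + 1) L) ⟨
    θ· digitSum a m (b ∷ L) ∎
    where open ≡-Reasoning

  digitSum-pred : ∀ m L → digitSum a m L ≡ θ⁻¹· digitSum a (m + + 1) L
  digitSum-pred m L = sym (trans (cong θ⁻¹·_ (digitSum-suc m L)) (θ⁻¹·θ· _))

  digitSum-0∷ : ∀ m L → digitSum a m (0 ∷ L) ≡ digitSum a (m + + 1) L
  digitSum-0∷ m L = trans (cong (_⊕ digitSum a (m + + 1) L) (mulθ-0 (θpow a m))) (⊕-identityˡ _)

  digitSum-∷ : ∀ c L → digitSum a +0 (c ∷ L) ≡ ⌜ c ⌝ ⊕ θ· digitSum a +0 L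
  digitSum-∷ c L = cong₂ _⊕_ (mulθ-⌜⌝-1 c) (digitSum-suc +0 L)

  digitSum-shift : ∀ e m L → digitSum a (m + e) L ≡ θ^ℤ e · digitSum a m L
  digitSum-shift (+ zero) m L = cong (λ k → digitSum a k L) (ℤ.+-identityʳ m)
  digitSum-shift (+ suc n) m L = begin
    digitSum a (m + + suc n) L    ≡⟨ cong (λ k → digitSum a k L) (ring m (+ n)) ⟩
    digitSum a (m + + n + + 1) L  ≡⟨ digitSum-suc (m + + n) L ⟩
    θ· digitSum a (m + + n) L     ≡⟨ cong θ·_ (digitSum-shift (+ n) m L) ⟩
    θ^ suc n · digitSum a m L     ∎
    where
    open ≡-Reasoning
    ring : ∀ m n → m + (+ 1 + n) ≡ m + n + + 1
    ring = solve-∀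
  digitSum-shift -[1+ zero ] m L = begin
    digitSum a (m - + 1) L              ≡⟨ digitSum-pred (m - + 1) L ⟩
    θ⁻¹· digitSum a (m - + 1 + + 1) L   ≡⟨ cong (λ k → θ⁻¹· digitSum a k L) (ring m) ⟩
    θ⁻¹· digitSum a m L                 ∎
    where
    open ≡-Reasoning
    ring : ∀ m → m - + 1 + + 1 ≡ m
    ring = solve-∀
  digitSum-shift -[1+ suc n ] m L = begin
    digitSum a (m + -[1+ suc n ]) L                 ≡⟨ digitSum-pred _ L ⟩
    θ⁻¹· digitSum a (m + -[1+ suc n ] + + 1) L     ≡⟨ cong (λ k → θ⁻¹· digitSum a k L) (ring m (+ n)) ⟩
    θ⁻¹· digitSum a (m + -[1+ n ]) L               ≡⟨ cong θ⁻¹·_ (digitSum-shift -[1+ n ] m L) ⟩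
    θ⁻^ suc (suc n) · digitSum a m L                ∎
    where
    open ≡-Reasoning
    ring : ∀ m n → m - (+ 1 + (+ 1 + n)) + + 1 ≡ m - (+ 1 + n)
    ring = solve-∀

  -- Greedy expansions of the window

  -- The conjugates of the sums Σ bᵢθⁱ (i ≥ 0, 0 ≤ bᵢ ≤ a) lie strictly between
  -- −a θ⁻¹/(1 − θ⁻²) = −1 and a/(1 − θ⁻²) = θ.
  Window : Zθ → Set
  Window v = Positive (conj v ⊕ ⌜ 1 ⌝) × Positive (θel ⊖ conj v)

  conj-0 : conj zθ ≡ zθ
  conj-0 = coords (trans (ℤ.+-identityˡ _) (ℤ.*-zeroʳ A)) refl

  Window-0 : Window zθ
  Window-0 = subst (λ z → Positive (z ⊕ ⌜ 1 ⌝)) (sym conj-0) (Natural⇒Positive 1 0 (s≤s z≤n)) ,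
             subst (λ z → Positive (θel ⊖ z)) (sym conj-0) (Natural⇒Positive 0 1 (s≤s z≤n))

  Window-digit : ∀ c V → c ≤ a → NonNegative V → Window V →
                 NonNegative (⌜ c ⌝ ⊕ θ· V) × Window (⌜ c ⌝ ⊕ θ· V)
  Window-digit c V@(⟨ x , y ⟩) c≤a V≥0 (σV>-1 , σV<θ) =
    NonNegative-⊕ (NonNegative-natural c 0) (NonNegative-θ· V≥0) ,
    subst Positive (sym lower) (NonNegative-⊕-Positive (NonNegative-natural c 0) (Positive-θ⁻¹· σV<θ)) ,
    subst Positive (sym upper) (NonNegative-⊕-Positive (NonNegative-∸ c≤a) (Positive-θ⁻¹· σV>-1))
    where
    C = + c
    lower : conj (⌜ c ⌝ ⊕ θ· V) ⊕ ⌜ 1 ⌝ ≡ ⌜ c ⌝ ⊕ θ⁻¹· (θel ⊖ conj V)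
    lower = coords (ring₁ C x y A) (ring₂ x y A)
      where
      ring₁ : ∀ C x y A → (C + y) + A * (+0 + (x + A * y)) + + 1 ≡ C + ((+ 1 + - - y) - A * (+0 + - (x + A * y)))
      ring₁ = solve-∀
      ring₂ : ∀ x y A → - (+0 + (x + A * y)) + +0 ≡ +0 + (+0 + - (x + A * y))
      ring₂ = solve-∀
    upper : θel ⊖ conj (⌜ c ⌝ ⊕ θ· V) ≡ ⟨ A - C , +0 ⟩ ⊕ θ⁻¹· (conj V ⊕ ⌜ 1 ⌝)
    upper = coords (ring₁ C x y A) (ring₂ x y A)
      where
      ring₁ : ∀ C x y A → +0 + - ((C + y) + A * (+0 + (x + A * y))) ≡ (A - C) + ((- y + +0) - A * (x + A * y + + 1))
      ring₁ = solve-∀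
      ring₂ : ∀ x y A → + 1 + - - (+0 + (x + A * y)) ≡ +0 + (x + A * y + + 1)
      ring₂ = solve-∀

  digitSum-Window : ∀ L → AllDigits a L → NonNegative (digitSum a +0 L) × Window (digitSum a +0 L)
  digitSum-Window [] _ = inj₂ refl , Window-0
  digitSum-Window (c ∷ L) (c≤a , L-digits) =
    subst (λ v → NonNegative v × Window v) (sym (digitSum-∷ c L))
      (Window-digit c (digitSum a +0 L) c≤a (proj₁ IH) (proj₂ IH))
    where IH = digitSum-Window L L-digits

  θ⁻¹ : Zθ
  θ⁻¹ = θinv a

  θ-1 : Zθ
  θ-1 = ⟨ -[1+ 0 ] , + 1 ⟩

  Positive-θ⁻¹ : Positive θ⁻¹
  Positive-θ⁻¹ = Positive-θ·⁻ (subst Positive (sym θ·θ⁻¹≡1) (Natural⇒Positive 1 0 (s≤s z≤n)))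
    where
    θ·θ⁻¹≡1 : θ· θ⁻¹ ≡ ⌜ 1 ⌝
    θ·θ⁻¹≡1 = coords refl (ring A)
      where ring : ∀ A → - A + A * + 1 ≡ +0
            ring = solve-∀

  ⌜a⌝⊕θ⁻¹≡θ : ⌜ a ⌝ ⊕ θ⁻¹ ≡ θel
  ⌜a⌝⊕θ⁻¹≡θ = coords (ℤ.+-inverseʳ A) refl

  -- below this bound the lowest greedy digit of v is not a
  BelowTop : Zθ → Set
  BelowTop v = Positive (θ-1 ⊖ conj v)

  -- the interval of conj α that determines the lowest greedy digit of α
  data DigitInterval (s : Zθ) : ℕ → Set where
    first : Positive (s ⊕ ⌜ 1 ⌝) → Positive (⌜ 0 ⌝ ⊕ θ⁻¹ ⊖ s) → DigitInterval s 0
    next : ∀ {k} → Positive (s ⊖ (⌜ k ⌝ ⊕ θ⁻¹)) → Positive (⌜ suc k ⌝ ⊕ θ⁻¹ ⊖ s) →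
           DigitInterval s (suc k)

  digitInterval : ∀ p q → Window ⟨ + p , + q ⟩ →
                  Σ ℕ λ c → c ≤ a × DigitInterval (conj ⟨ + p , + q ⟩) c
  digitInterval p q (s>-1 , s<θ) =
    search a ℕ.≤-refl (subst (λ v → Positive (v ⊖ s)) (sym ⌜a⌝⊕θ⁻¹≡θ) s<θ)
    where
    s = conj ⟨ + p , + q ⟩
    -- the θ-coordinate of s is −q ≤ 0, that of k + θ⁻¹ is 1
    off-grid : ∀ q → - + q + -[1+ 0 ] ≢ +0
    off-grid zero ()
    off-grid (suc q) ()
    search : ∀ k → k ≤ a → Positive (⌜ k ⌝ ⊕ θ⁻¹ ⊖ s) → Σ ℕ λ c → c ≤ a × DigitInterval s c
    search zero _ s<θ⁻¹ = 0 , z≤n , first s>-1 s<θ⁻¹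
    search (suc k) k<a s<k+1+θ⁻¹ with sign (s ⊖ (⌜ k ⌝ ⊕ θ⁻¹))
    ... | positive s>k+θ⁻¹ = suc k , k<a , next s>k+θ⁻¹ s<k+1+θ⁻¹
    ... | zero s≡k+θ⁻¹ = ⊥-elim (off-grid q (cong im s≡k+θ⁻¹))
    ... | negative s<k+θ⁻¹ = search k (ℕ.<⇒≤ k<a) (subst Positive (⊝-⊖ s _) s<k+θ⁻¹)

  -- For α = p + qθ with p, q ∈ ℕ we have α ≥ conj α, and α ≥ θ > a once q > 0.
  digit-below-natural : ∀ p q {k} → k ℕ.< a → Positive (conj ⟨ + p , + q ⟩ ⊖ (⌜ k ⌝ ⊕ θ⁻¹)) →
                        NonNegative (⟨ + p , + q ⟩ ⊖ ⌜ suc k ⌝)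
  digit-below-natural p (suc q′) {k} k<a _ = subst NonNegative (sym split′)
    (inj₁ (Positive-⊕-NonNegative (NonNegative-⊕-Positive (NonNegative-natural p q′) Positive-θ⁻¹)
                                  (NonNegative-∸ k<a)))
    where
    split′ : ⟨ + p , + suc q′ ⟩ ⊖ ⌜ suc k ⌝ ≡ ⟨ + p , + q′ ⟩ ⊕ θ⁻¹ ⊕ ⟨ A - + suc k , +0 ⟩
    split′ = coords (ring₁ (+ p) (+ suc k) A) (ring₂ (+ q′))
      where
      ring₁ : ∀ P C A → P + - C ≡ (P + - A) + (A - C)
      ring₁ = solve-∀
      ring₂ : ∀ Q → (+ 1 + Q) + +0 ≡ (Q + + 1) + +0
      ring₂ = solve-∀
  digit-below-natural p zero {k} _ s>k+θ⁻¹ with p ℕ.≤? k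
  ... | no p≰k = NonNegative-∸ (ℕ.≰⇒> p≰k)
  ... | yes p≤k = ⊥-elim (Positive⇒¬NonNegative-⊝ s>k+θ⁻¹
        (inj₁ (subst Positive (sym (integer (+ p) (+ k)))
                 (NonNegative-⊕-Positive (NonNegative-∸ p≤k) Positive-θ⁻¹))))
    where
    integer : ∀ P K → ⊝ (conj ⟨ P , +0 ⟩ ⊖ (⟨ K , +0 ⟩ ⊕ θ⁻¹)) ≡ ⟨ K - P , +0 ⟩ ⊕ θ⁻¹
    integer P K = coords (ring P K A) refl
      where ring : ∀ P K A → - ((P + A * +0) + - (K + - A)) ≡ (K - P) + - A
            ring = solve-∀

  record DigitStep (α : Zθ) : Set where
    field
      digit : ℕ
      rest : Zθ
      digit≤a : digit ≤ a
      split : α ≡ ⌜ digit ⌝ ⊕ θ· rest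
      rest≥0 : NonNegative rest
      rest-window : Window rest
      rest-below-top : digit ≢ 0 → BelowTop rest
      below-top⇒digit≢a : BelowTop α → digit ≢ a

  -- The digit c is read off the interval containing conj α, and the rest is (α − c)/θ,
  -- whose conjugate is −θ (conj α − c).
  digitStep : ∀ p q → Window ⟨ + p , + q ⟩ → DigitStep ⟨ + p , + q ⟩
  digitStep p q window with digitInterval p q window
  ... | c , c≤a , interval = record
    { digit = c
    ; rest = θ⁻¹· (α ⊖ ⌜ c ⌝)
    ; digit≤a = c≤a
    ; split = sym (trans (cong (⌜ c ⌝ ⊕_) (θ·θ⁻¹· (α ⊖ ⌜ c ⌝))) (⌜c⌝⊕[v⊖⌜c⌝] α))
    ; rest≥0 = NonNegative-θ⁻¹· (α-c≥0 interval c≤a)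
    ; rest-window = subst Positive (sym (lower α)) (Positive-θ· (below interval)) ,
                    subst Positive (sym (upper α)) (Positive-θ· (above interval))
    ; rest-below-top = rest-below-top interval
    ; below-top⇒digit≢a = digit≢a interval
    }
    where
    α = ⟨ + p , + q ⟩
    s = conj α
    C = + c

    ⌜c⌝⊕[v⊖⌜c⌝] : ∀ v → ⌜ c ⌝ ⊕ (v ⊖ ⌜ c ⌝) ≡ v
    ⌜c⌝⊕[v⊖⌜c⌝] ⟨ x , y ⟩ = coords (ring₁ x C) (ring₂ y)
      where
      ring₁ : ∀ x C → C + (x + - C) ≡ x
      ring₁ = solve-∀
      ring₂ : ∀ y → +0 + (y + +0) ≡ y
      ring₂ = solve-∀

    lower : ∀ v → conj (θ⁻¹· (v ⊖ ⌜ c ⌝)) ⊕ ⌜ 1 ⌝ ≡ θ· (⌜ c ⌝ ⊕ θ⁻¹ ⊖ conj v)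
    lower ⟨ x , y ⟩ = coords (ring₁ x y C A) (ring₂ x y C A)
      where
      ring₁ : ∀ x y C A → ((y + +0) - A * (x + - C)) + A * (x + - C) + + 1 ≡ + 1 + - - y
      ring₁ = solve-∀
      ring₂ : ∀ x y C A → - (x + - C) + +0 ≡ ((C + - A) + - (x + A * y)) + A * (+ 1 + - - y)
      ring₂ = solve-∀

    upper : ∀ v → θel ⊖ conj (θ⁻¹· (v ⊖ ⌜ c ⌝)) ≡ θ· (conj v ⊕ ⌜ 1 ⌝ ⊖ ⌜ c ⌝)
    upper ⟨ x , y ⟩ = coords (ring₁ x y C A) (ring₂ x y C A)
      where
      ring₁ : ∀ x y C A → +0 + - (((y + +0) - A * (x + - C)) + A * (x + - C)) ≡ (- y + +0) + +0
      ring₁ = solve-∀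
      ring₂ : ∀ x y C A → + 1 + - - (x + - C) ≡ (((x + A * y) + + 1) + - C) + A * ((- y + +0) + +0)
      ring₂ = solve-∀

    below : ∀ {c} → DigitInterval s c → Positive (⌜ c ⌝ ⊕ θ⁻¹ ⊖ s)
    below (first _ s<θ⁻¹) = s<θ⁻¹
    below (next _ s<k+1+θ⁻¹) = s<k+1+θ⁻¹

    above : ∀ {c} → DigitInterval s c → Positive (s ⊕ ⌜ 1 ⌝ ⊖ ⌜ c ⌝)
    above (first s>-1 _) = subst Positive (sym (⊖-⌜0⌝ (s ⊕ ⌜ 1 ⌝))) s>-1
    above {suc k} (next s>k+θ⁻¹ _) =
      subst Positive (shift (+ k) s) (Positive-⊕ s>k+θ⁻¹ Positive-θ⁻¹)
      where
      shift : ∀ K v → (v ⊖ (⟨ K , +0 ⟩ ⊕ θ⁻¹)) ⊕ θ⁻¹ ≡ v ⊕ ⌜ 1 ⌝ ⊖ ⟨ + 1 + K , +0 ⟩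
      shift K ⟨ u , w ⟩ = coords (ring₁ u K A) (ring₂ w)
        where
        ring₁ : ∀ u K A → (u + - (K + - A)) + - A ≡ (u + + 1) + - (+ 1 + K)
        ring₁ = solve-∀
        ring₂ : ∀ w → (w + - (+0 + + 1)) + + 1 ≡ (w + +0) + +0
        ring₂ = solve-∀

    rest-below-top : ∀ {c} → DigitInterval s c → c ≢ 0 → BelowTop (θ⁻¹· (α ⊖ ⌜ c ⌝))
    rest-below-top (first _ _) c≢0 = ⊥-elim (c≢0 refl)
    rest-below-top {suc k} (next s>k+θ⁻¹ _) _ =
      subst Positive (sym (top (+ k) α)) (Positive-θ· s>k+θ⁻¹)
      where
      top : ∀ K v → θ-1 ⊖ conj (θ⁻¹· (v ⊖ ⟨ + 1 + K , +0 ⟩)) ≡ θ· (conj v ⊖ (⟨ K , +0 ⟩ ⊕ θ⁻¹))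
      top K ⟨ x , y ⟩ = coords (ring₁ x y K A) (ring₂ x y K A)
        where
        ring₁ : ∀ x y K A → - (+ 1) + - (((y + +0) - A * (x + - (+ 1 + K))) + A * (x + - (+ 1 + K))) ≡
                            - y + - (+0 + + 1)
        ring₁ = solve-∀
        ring₂ : ∀ x y K A → + 1 + - - (x + - (+ 1 + K)) ≡ ((x + A * y) + - (K + - A)) + A * (- y + - (+0 + + 1))
        ring₂ = solve-∀

    digit≢a : ∀ {c} → DigitInterval s c → BelowTop α → c ≢ a
    digit≢a (first _ _) _ ()
    digit≢a (next s>a-1+θ⁻¹ _) s<θ-1 refl =
      Positive⇒¬NonNegative-⊝ s<θ-1 (inj₁ (subst Positive (top-digit s) s>a-1+θ⁻¹))
      where
      top-digit : ∀ v → v ⊖ (⌜ a-1 ⌝ ⊕ θ⁻¹) ≡ ⊝ (θ-1 ⊖ v)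
      top-digit ⟨ u , w ⟩ = coords (ring₁ u (+ a-1)) (ring₂ w)
        where
        ring₁ : ∀ u A′ → u + - (A′ + - (+ 1 + A′)) ≡ - (- (+ 1) + - u)
        ring₁ = solve-∀
        ring₂ : ∀ w → w + - (+0 + + 1) ≡ - (+ 1 + - w)
        ring₂ = solve-∀

    α-c≥0 : ∀ {c} → DigitInterval s c → c ≤ a → NonNegative (α ⊖ ⌜ c ⌝)
    α-c≥0 (first _ _) _ = subst NonNegative (sym (⊖-⌜0⌝ α)) (NonNegative-natural p q)
    α-c≥0 (next s>k+θ⁻¹ _) k<a = digit-below-natural p q k<a s>k+θ⁻¹

  -- A point of the window with v ≥ 0 has natural coordinates: a negative θ-coordinate
  -- pushes conj v above θ, a negative constant coordinate pushes it below −1.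
  natural-coords : ∀ {v} → NonNegative v → Window v → Σ ℕ λ p → Σ ℕ λ q → v ≡ ⟨ + p , + q ⟩
  natural-coords {⟨ x , -[1+ k ] ⟩} v≥0 (_ , σv<θ) =
    ⊥-elim (Positive⇒¬NonNegative-⊝ (Positive-⊕-NonNegative σv<θ v≥0)
                                     (inj₁ (Positive-θ·⁻ θ·[σv-θ-v]>0)))
    where
    K = + k
    θ·[σv-θ-v]>0 : Positive (θ· ⊝ ((θel ⊖ conj ⟨ x , -[1+ k ] ⟩) ⊕ ⟨ x , -[1+ k ] ⟩))
    θ·[σv-θ-v]>0 = subst Positive (sym (trans (coords (ring₁ K) (ring₂ x K A)) (coords refl (sym (ℤ.pos-* a k)))))
                     (Natural⇒Positive (suc (k ℕ.+ k)) (a ℕ.* k) (s≤s z≤n))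
      where
      ring₁ : ∀ K → - ((+ 1 + - - - (+ 1 + K)) + - (+ 1 + K)) ≡ + 1 + (K + K)
      ring₁ = solve-∀
      ring₂ : ∀ x K A → - ((+0 + - (x + A * - (+ 1 + K))) + x) +
                        A * - ((+ 1 + - - - (+ 1 + K)) + - (+ 1 + K)) ≡ A * K
      ring₂ = solve-∀
  natural-coords {⟨ -[1+ k ] , + q ⟩} _ (σv>-1 , _) =
    ⊥-elim (Positive⇒¬NonNegative-⊝ σv>-1
              (NonNegative-θ·⁻ (subst NonNegative (sym θ·[-σv-1]≡) (NonNegative-natural q k))))
    where
    θ·[-σv-1]≡ : θ· ⊝ (conj ⟨ -[1+ k ] , + q ⟩ ⊕ ⌜ 1 ⌝) ≡ ⟨ + q , + k ⟩
    θ·[-σv-1]≡ = coords (ring₁ (+ q)) (ring₂ (+ k) (+ q) A)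
      where
      ring₁ : ∀ Q → - (- Q + +0) ≡ Q
      ring₁ = solve-∀
      ring₂ : ∀ K Q A → - ((- (+ 1 + K) + A * Q) + + 1) + A * - (- Q + +0) ≡ K
      ring₂ = solve-∀
  natural-coords {⟨ + p , + q ⟩} _ _ = p , q , refl

  HeadIs : ℕ → List ℕ → Set
  HeadIs d [] = ⊥
  HeadIs d (b ∷ _) = b ≡ d

  record Expansion (v : Zθ) : Set where
    field
      digits : List ℕ
      digits≤a : AllDigits a digits
      greedy : GreedyCond a digits
      sum : v ≡ digitSum a +0 digits
      below-top⇒¬a : BelowTop v → ¬ HeadIs a digits

  Expansion-0 : Expansion zθ
  Expansion-0 = record { digits = [] ; digits≤a = _ ; greedy = _ ; sum = refl ; below-top⇒¬a = λ _ () }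

  Expansion-∷ : ∀ {α} (step : DigitStep α) → Expansion (DigitStep.rest step) → Expansion α
  Expansion-∷ step β-expansion = record
    { digits = digit ∷ digits
    ; digits≤a = digit≤a , digits≤a
    ; greedy = greedy-∷ digits greedy below-top⇒¬a
    ; sum = trans split (trans (cong (λ v → ⌜ digit ⌝ ⊕ θ· v) sum) (sym (digitSum-∷ digit digits)))
    ; below-top⇒¬a = below-top⇒digit≢a
    }
    where
    open DigitStep step
    open Expansion β-expansion
    greedy-∷ : ∀ L → GreedyCond a L → (BelowTop rest → ¬ HeadIs a L) → GreedyCond a (digit ∷ L)
    greedy-∷ [] _ _ = _
    greedy-∷ (d ∷ L) greedy-L top = d≡a⇒digit≡0 digit refl , greedy-L
      where
      d≡a⇒digit≡0 : ∀ c → c ≡ digit → d ≡ a → c ≡ 0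
      d≡a⇒digit≡0 zero _ _ = refl
      d≡a⇒digit≡0 (suc c) refl d≡a = ⊥-elim (top (rest-below-top (λ ())) d≡a)

  size : ℕ → ℕ → ℕ
  size p q = p ℕ.+ q ℕ.+ q

  size-decreasing : ∀ c p′ q′ → 0 ℕ.< (c ℕ.+ q′) ℕ.+ (p′ ℕ.+ a ℕ.* q′) →
                    size p′ q′ ℕ.< size (c ℕ.+ q′) (p′ ℕ.+ a ℕ.* q′)
  size-decreasing c p′ q′ α≢0 =
    subst (size p′ q′ ℕ.<_) (sym (ring c p′ q′ a-1))
      (ℕ.m<m+n (size p′ q′) (ℕ.<-≤-trans (nonzero c p′ q′ α≢0) (ℕ.m≤m+n _ _)))
    where
    ring : ∀ c p q b → (c ℕ.+ q) ℕ.+ (p ℕ.+ (1 ℕ.+ b) ℕ.* q) ℕ.+ (p ℕ.+ (1 ℕ.+ b) ℕ.* q) ≡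
                      (p ℕ.+ q ℕ.+ q) ℕ.+ ((c ℕ.+ p ℕ.+ q) ℕ.+ (b ℕ.* q ℕ.+ b ℕ.* q))
    ring = ℕ-Ring.solve-∀
    nonzero : ∀ c p q → 0 ℕ.< (c ℕ.+ q) ℕ.+ (p ℕ.+ a ℕ.* q) → 0 ℕ.< c ℕ.+ p ℕ.+ q
    nonzero (suc c) p q _ = s≤s z≤n
    nonzero zero (suc p) q _ = s≤s z≤n
    nonzero zero zero (suc q) _ = s≤s z≤n
    nonzero zero zero zero 0<a*0 = ⊥-elim (ℕ.<-irrefl refl (subst (0 ℕ.<_) (ℕ.*-zeroʳ a) 0<a*0))

  expansion-natural : ∀ n p q → size p q ℕ.< n → Window ⟨ + p , + q ⟩ → Expansion ⟨ + p , + q ⟩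
  expansion-positive : ∀ n p q → 0 ℕ.< p ℕ.+ q → size p q ℕ.< suc n → Window ⟨ + p , + q ⟩ →
                       Expansion ⟨ + p , + q ⟩

  expansion-natural _ zero zero _ _ = Expansion-0
  expansion-natural (suc n) (suc p) q = expansion-positive n (suc p) q (s≤s z≤n)
  expansion-natural (suc n) zero (suc q) = expansion-positive n zero (suc q) (s≤s z≤n)

  expansion-positive n p q α≢0 size<1+n window =
    Expansion-∷ step (expansion-rest (natural-coords rest≥0 rest-window))
    where
    step = digitStep p q window
    open DigitStep step
    expansion-rest : (Σ ℕ λ p′ → Σ ℕ λ q′ → rest ≡ ⟨ + p′ , + q′ ⟩) → Expansion rest
    expansion-rest (p′ , q′ , rest≡) =
      subst Expansion (sym rest≡) (expansion-natural n p′ q′ size′<n (subst Window rest≡ rest-window))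
      where
      split′ : ⟨ + p , + q ⟩ ≡ ⌜ digit ⌝ ⊕ θ· ⟨ + p′ , + q′ ⟩
      split′ = trans split (cong (λ v → ⌜ digit ⌝ ⊕ θ· v) rest≡)
      p≡ : p ≡ digit ℕ.+ q′
      p≡ = ℤ.+-injective (cong re split′)
      q≡ : q ≡ p′ ℕ.+ a ℕ.* q′
      q≡ = ℤ.+-injective
        (trans (cong im split′) (trans (ℤ.+-identityˡ _) (cong (_+_ (+ p′)) (sym (ℤ.pos-* a q′)))))
      size′<n : size p′ q′ ℕ.< n
      size′<n = ℕ.<-≤-trans
        (subst₂ (λ p q → size p′ q′ ℕ.< size p q) (sym p≡) (sym q≡)
           (size-decreasing digit p′ q′ (subst₂ (λ p q → 0 ℕ.< p ℕ.+ q) p≡ q≡ α≢0)))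
        (ℕ.≤-pred size<1+n)

  expansion : ∀ {v} → NonNegative v → Window v → Expansion v
  expansion v≥0 window with natural-coords v≥0 window
  ... | p , q , refl = expansion-natural (suc (size p q)) p q ℕ.≤-refl window

  -- Sums and differences of greedy sums

  infix 4 _≡±_

  _≡±_ : Zθ → Zθ → Set
  v ≡± w = v ≡ w ⊎ v ≡ ⊝ w

  ≡±-trans : ∀ {u v w} → u ≡± v → v ≡± w → u ≡± w
  ≡±-trans (inj₁ refl) v≡±w = v≡±w
  ≡±-trans (inj₂ refl) (inj₁ refl) = inj₂ refl
  ≡±-trans (inj₂ refl) (inj₂ refl) = inj₁ (⊝-involutive _)

  ≡±-map : ∀ (f : Zθ → Zθ) → (∀ v → f (⊝ v) ≡ ⊝ f v) → ∀ {v w} → v ≡± w → f v ≡± f w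
  ≡±-map f f-odd (inj₁ refl) = inj₁ refl
  ≡±-map f f-odd (inj₂ refl) = inj₂ (f-odd _)

  GreedySum : ℤ → Zθ → Set
  GreedySum m v = Σ (List ℕ) λ L → AllDigits a L × GreedyCond a L × v ≡± digitSum a m L

  θ² θ³ : Zθ
  θ² = ⟨ + 1 , A ⟩
  θ³ = ⟨ A , A * A + + 1 ⟩

  -- δ lies in the wide window iff θ²δ lies in the window
  WideWindow : Zθ → Set
  WideWindow δ = Positive (conj δ ⊕ θ²) × Positive (θ³ ⊖ conj δ)

  GreedySum-wide : ∀ {δ} → NonNegative δ → WideWindow δ → GreedySum -[1+ 1 ] δ
  GreedySum-wide {δ@(⟨ x , y ⟩)} δ≥0 (σδ>-θ² , σδ<θ³) = digits , digits≤a , greedy , inj₁ δ≡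
    where
    lower : conj (θ· θ· δ) ⊕ ⌜ 1 ⌝ ≡ θ⁻¹· θ⁻¹· (conj δ ⊕ θ²)
    lower = coords (ring₁ x y A) (ring₂ x y A)
      where
      ring₁ : ∀ x y A → (x + A * y) + A * (y + A * (x + A * y)) + + 1 ≡
                        ((x + A * y) + + 1) - A * ((- y + A) - A * ((x + A * y) + + 1))
      ring₁ = solve-∀
      ring₂ : ∀ x y A → - (y + A * (x + A * y)) + +0 ≡ (- y + A) - A * ((x + A * y) + + 1)
      ring₂ = solve-∀
    upper : θel ⊖ conj (θ· θ· δ) ≡ θ⁻¹· θ⁻¹· (θ³ ⊖ conj δ)
    upper = coords (ring₁ x y A) (ring₂ x y A)
      where
      ring₁ : ∀ x y A → +0 + - ((x + A * y) + A * (y + A * (x + A * y))) ≡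
                        (A + - (x + A * y)) - A * (((A * A + + 1) + - - y) - A * (A + - (x + A * y)))
      ring₁ = solve-∀
      ring₂ : ∀ x y A → + 1 + - - (y + A * (x + A * y)) ≡ ((A * A + + 1) + - - y) - A * (A + - (x + A * y))
      ring₂ = solve-∀
    open Expansion (expansion (NonNegative-θ· (NonNegative-θ· δ≥0))
                      (subst Positive (sym lower) (Positive-θ⁻¹· (Positive-θ⁻¹· σδ>-θ²)) ,
                       subst Positive (sym upper) (Positive-θ⁻¹· (Positive-θ⁻¹· σδ<θ³))))
    δ≡ : δ ≡ digitSum a -[1+ 1 ] digits
    δ≡ = begin
      δ                                   ≡⟨ trans (cong θ⁻¹·_ (θ⁻¹·θ· (θ· δ))) (θ⁻¹·θ· δ) ⟨
      θ⁻¹· θ⁻¹· θ· θ· δ                   ≡⟨ cong (λ v → θ⁻¹· θ⁻¹· v) sum ⟩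
      θ⁻¹· θ⁻¹· digitSum a +0 digits      ≡⟨ digitSum-shift -[1+ 1 ] +0 digits ⟨
      digitSum a -[1+ 1 ] digits          ∎
      where open ≡-Reasoning

  WideWindow-⊖ : ∀ {X Y} → Window X → Window Y → WideWindow (X ⊖ Y)
  WideWindow-⊖ {X@(⟨ x , y ⟩)} {Y@(⟨ u , w ⟩)} (σX>-1 , σX<θ) (σY>-1 , σY<θ) =
    subst Positive (sym lower) (Positive-⊕-NonNegative (Positive-⊕ σX>-1 σY<θ) (NonNegative-natural 0 a-1)) ,
    subst Positive (sym upper) (Positive-⊕-NonNegative (Positive-⊕ σX<θ σY>-1) a-1+a²θ≥0)
    where
    A′ = + a-1
    lower : conj (X ⊖ Y) ⊕ θ² ≡ (conj X ⊕ ⌜ 1 ⌝) ⊕ (θel ⊖ conj Y) ⊕ ⟨ +0 , A′ ⟩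
    lower = coords (ring₁ x y u w A′) (ring₂ x y u w A′)
      where
      ring₁ : ∀ x y u w A′ → (x + - u) + (+ 1 + A′) * (y + - w) + + 1 ≡
                             ((x + (+ 1 + A′) * y) + + 1 + (+0 + - (u + (+ 1 + A′) * w))) + +0
      ring₁ = solve-∀
      ring₂ : ∀ x y u w A′ → - (y + - w) + (+ 1 + A′) ≡ ((- y + +0) + (+ 1 + - - w)) + A′
      ring₂ = solve-∀
    upper : θ³ ⊖ conj (X ⊖ Y) ≡ (θel ⊖ conj X) ⊕ (conj Y ⊕ ⌜ 1 ⌝) ⊕ ⟨ A′ , A * A ⟩
    upper = coords (ring₁ x y u w A′) (ring₂ x y u w A)
      where
      ring₁ : ∀ x y u w A′ → (+ 1 + A′) + - ((x + - u) + (+ 1 + A′) * (y + - w)) ≡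
                             ((+0 + - (x + (+ 1 + A′) * y)) + ((u + (+ 1 + A′) * w) + + 1)) + A′
      ring₁ = solve-∀
      ring₂ : ∀ x y u w A → (A * A + + 1) + - - (y + - w) ≡ ((+ 1 + - - y) + (- w + +0)) + A * A
      ring₂ = solve-∀
    a-1+a²θ≥0 : NonNegative ⟨ A′ , A * A ⟩
    a-1+a²θ≥0 = subst (λ z → NonNegative ⟨ A′ , z ⟩) (ℤ.pos-* a a) (NonNegative-natural a-1 (a ℕ.* a))

  Positive-θ-1 : Positive θ-1
  Positive-θ-1 = Positive-θ·⁻ (subst Positive (sym θ·[θ-1]) (Natural⇒Positive 1 a-1 (s≤s z≤n)))
    where
    θ·[θ-1] : θ· θ-1 ≡ ⟨ + 1 , + a-1 ⟩
    θ·[θ-1] = coords refl (ring (+ a-1))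
      where ring : ∀ A′ → - (+ 1) + (+ 1 + A′) * + 1 ≡ A′
            ring = solve-∀

  WideWindow-⊕ : ∀ {X Y} → Window X → Window Y → WideWindow (X ⊕ Y)
  WideWindow-⊕ {X@(⟨ x , y ⟩)} {Y@(⟨ u , w ⟩)} (σX>-1 , σX<θ) (σY>-1 , σY<θ) =
    subst Positive (sym lower)
      (Positive-⊕ (Positive-⊕ σX>-1 σY>-1) (Positive-⊕-NonNegative Positive-θ-1 (NonNegative-natural 0 a-1))) ,
    subst Positive (sym upper) (Positive-⊕-NonNegative (Positive-⊕ σX<θ σY<θ) a+[a²-1]θ≥0)
    where
    A′ = + a-1
    lower : conj (X ⊕ Y) ⊕ θ² ≡ (conj X ⊕ ⌜ 1 ⌝) ⊕ (conj Y ⊕ ⌜ 1 ⌝) ⊕ (θ-1 ⊕ ⟨ +0 , A′ ⟩)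
    lower = coords (ring₁ x y u w A′) (ring₂ y w A′)
      where
      ring₁ : ∀ x y u w A′ → (x + u) + (+ 1 + A′) * (y + w) + + 1 ≡
                             ((x + (+ 1 + A′) * y) + + 1 + ((u + (+ 1 + A′) * w) + + 1)) + (- (+ 1) + +0)
      ring₁ = solve-∀
      ring₂ : ∀ y w A′ → - (y + w) + (+ 1 + A′) ≡ ((- y + +0) + (- w + +0)) + (+ 1 + A′)
      ring₂ = solve-∀
    upper : θ³ ⊖ conj (X ⊕ Y) ≡ (θel ⊖ conj X) ⊕ (θel ⊖ conj Y) ⊕ ⟨ A , A′ + A′ * A ⟩
    upper = coords (ring₁ x y u w A′) (ring₂ y w A′)
      where
      ring₁ : ∀ x y u w A′ → (+ 1 + A′) + - ((x + u) + (+ 1 + A′) * (y + w)) ≡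
                             ((+0 + - (x + (+ 1 + A′) * y)) + (+0 + - (u + (+ 1 + A′) * w))) + (+ 1 + A′)
      ring₁ = solve-∀
      ring₂ : ∀ y w A′ → ((+ 1 + A′) * (+ 1 + A′) + + 1) + - - (y + w) ≡
                         ((+ 1 + - - y) + (+ 1 + - - w)) + (A′ + A′ * (+ 1 + A′))
      ring₂ = solve-∀
    a+[a²-1]θ≥0 : NonNegative ⟨ A , A′ + A′ * A ⟩
    a+[a²-1]θ≥0 = subst (λ z → NonNegative ⟨ A , A′ + z ⟩) (ℤ.pos-* a-1 a)
                    (NonNegative-natural a (a-1 ℕ.+ a-1 ℕ.* a))

  GreedySum-≡± : ∀ {m u v} → u ≡± v → GreedySum m v → GreedySum m u
  GreedySum-≡± u≡±v (L , L≤a , greedy , v≡±) = L , L≤a , greedy , ≡±-trans u≡±v v≡±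

  GreedySum-difference : ∀ {X Y} → Window X → Window Y → GreedySum -[1+ 1 ] (X ⊖ Y)
  GreedySum-difference {X} {Y} wX wY = by-sign (sign (X ⊖ Y))
    where
    by-sign : Sign (X ⊖ Y) → GreedySum -[1+ 1 ] (X ⊖ Y)
    by-sign (positive X>Y) = GreedySum-wide (inj₁ X>Y) (WideWindow-⊖ {X} {Y} wX wY)
    by-sign (zero X≡Y) = [] , _ , _ , inj₁ X≡Y
    by-sign (negative Y>X) = GreedySum-≡± (inj₂ (sym (⊝-⊖ Y X)))
      (GreedySum-wide (inj₁ (subst Positive (⊝-⊖ X Y) Y>X)) (WideWindow-⊖ {Y} {X} wY wX))

  GreedySum-sum : ∀ {X Y} → NonNegative X → Window X → NonNegative Y → Window Y → GreedySum -[1+ 1 ] (X ⊕ Y)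
  GreedySum-sum {X} {Y} X≥0 wX Y≥0 wY = GreedySum-wide (NonNegative-⊕ X≥0 Y≥0) (WideWindow-⊕ {X} {Y} wX wY)

  GreedySum-shift : ∀ e {m δ} → GreedySum m δ → GreedySum (m + e) (θ^ℤ e · δ)
  GreedySum-shift e {m} (L , L≤a , greedy , δ≡±) =
    L , L≤a , greedy , ≡±-trans (≡±-map (θ^ℤ e ·_) (θ^ℤ-⊝ e) δ≡±) (inj₁ (sym (digitSum-shift e m L)))

  ⊖-≡± : ∀ {u v U V} → u ≡± U → v ≡± V → u ⊖ v ≡± U ⊖ V ⊎ u ⊖ v ≡± U ⊕ V
  ⊖-≡± (inj₁ refl) (inj₁ refl) = inj₁ (inj₁ refl)
  ⊖-≡± {U = U} {V} (inj₁ refl) (inj₂ refl) = inj₂ (inj₁ (cong (U ⊕_) (⊝-involutive V)))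
  ⊖-≡± {U = U} {V} (inj₂ refl) (inj₁ refl) = inj₂ (inj₂ (sym (⊝-⊕ U V)))
  ⊖-≡± {U = U} {V} (inj₂ refl) (inj₂ refl) = inj₁ (inj₂ (sym (⊝-⊕ U (⊝ V))))

  GreedySum-⊖ : ∀ e {u v} → GreedySum e u → GreedySum e v → GreedySum (e - + 2) (u ⊖ v)
  GreedySum-⊖ e {u} {v} (L₁ , L₁≤a , _ , u≡±) (L₂ , L₂≤a , _ , v≡±) =
    subst (λ m → GreedySum m (u ⊖ v)) (ℤ.+-comm -[1+ 1 ] e)
      (combine (⊖-≡± (≡±-trans u≡± (inj₁ (from-0 L₁))) (≡±-trans v≡± (inj₁ (from-0 L₂)))))
    where
    X = digitSum a +0 L₁
    Y = digitSum a +0 L₂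
    from-0 : ∀ L → digitSum a e L ≡ θ^ℤ e · digitSum a +0 L
    from-0 L = trans (cong (λ m → digitSum a m L) (sym (ℤ.+-identityˡ e))) (digitSum-shift e +0 L)
    X≥0 = proj₁ (digitSum-Window L₁ L₁≤a)
    wX = proj₂ (digitSum-Window L₁ L₁≤a)
    Y≥0 = proj₁ (digitSum-Window L₂ L₂≤a)
    wY = proj₂ (digitSum-Window L₂ L₂≤a)
    θᵉ-⊖ : θ^ℤ e · X ⊖ θ^ℤ e · Y ≡ θ^ℤ e · (X ⊖ Y)
    θᵉ-⊖ = sym (trans (θ^ℤ-⊕ e X (⊝ Y)) (cong (θ^ℤ e · X ⊕_) (θ^ℤ-⊝ e Y)))
    combine : u ⊖ v ≡± θ^ℤ e · X ⊖ θ^ℤ e · Y ⊎ u ⊖ v ≡± θ^ℤ e · X ⊕ θ^ℤ e · Y →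
              GreedySum (-[1+ 1 ] + e) (u ⊖ v)
    combine (inj₁ u-v≡±) = GreedySum-≡± (≡±-trans u-v≡± (inj₁ θᵉ-⊖))
                             (GreedySum-shift e (GreedySum-difference {X} {Y} wX wY))
    combine (inj₂ u-v≡±) = GreedySum-≡± (≡±-trans u-v≡± (inj₁ (sym (θ^ℤ-⊕ e X Y))))
                             (GreedySum-shift e (GreedySum-sum {X} {Y} X≥0 wX Y≥0 wY))

  -- The valuation and the completion

  digitSum-zeros : ∀ k j L → digitSum a j (replicate k 0 ++ L) ≡ digitSum a (j + + k) L
  digitSum-zeros zero j L = cong (λ m → digitSum a m L) (sym (ℤ.+-identityʳ j))
  digitSum-zeros (suc k) j L =
    trans (digitSum-0∷ j (replicate k 0 ++ L))
      (trans (digitSum-zeros k (j + + 1) L) (cong (λ m → digitSum a m L) (ring j (+ k))))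
    where ring : ∀ j k → (j + + 1) + k ≡ j + (+ 1 + k)
          ring = solve-∀

  AllDigits-zeros : ∀ k L → AllDigits a L → AllDigits a (replicate k 0 ++ L)
  AllDigits-zeros zero L L≤a = L≤a
  AllDigits-zeros (suc k) L L≤a = z≤n , AllDigits-zeros k L L≤a

  GreedyCond-0∷ : ∀ L → GreedyCond a L → GreedyCond a (0 ∷ L)
  GreedyCond-0∷ [] _ = _
  GreedyCond-0∷ (_ ∷ _) greedy = (λ _ → refl) , greedy

  GreedyCond-zeros : ∀ k L → GreedyCond a L → GreedyCond a (replicate k 0 ++ L)
  GreedyCond-zeros zero L greedy = greedy
  GreedyCond-zeros (suc k) L greedy = GreedyCond-0∷ _ (GreedyCond-zeros k L greedy)

  GreedyCond-tail : ∀ b L → GreedyCond a (b ∷ L) → GreedyCond a L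
  GreedyCond-tail b [] _ = _
  GreedyCond-tail b (_ ∷ _) (_ , greedy) = greedy

  AbsLE-weaken : ∀ {w j j′} → j ℤ.≤ j′ → AbsLE a w j′ → AbsLE a w j
  AbsLE-weaken _ (inj₁ w≡0) = inj₁ w≡0
  AbsLE-weaken j≤j′ (inj₂ (m , expansion , j′≤m)) = inj₂ (m , expansion , ℤ.≤-trans j≤j′ j′≤m)

  AbsLE⇒GreedySum : ∀ {w e} → AbsLE a w e → GreedySum e w
  AbsLE⇒GreedySum (inj₁ w≡0) = [] , _ , _ , inj₁ w≡0
  AbsLE⇒GreedySum {e = e} (inj₂ (m , (b , bs , _ , L≤a , greedy , w≡±) , e≤m)) =
    replicate k 0 ++ (b ∷ bs) , AllDigits-zeros k _ L≤a , GreedyCond-zeros k _ greedy ,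
    ≡±-trans w≡± (inj₁ (trans (cong (λ j → digitSum a j (b ∷ bs)) m≡e+k)
                              (sym (digitSum-zeros k e (b ∷ bs)))))
    where
    k = ℤ.∣ m - e ∣
    m≡e+k : m ≡ e + + k
    m≡e+k = trans (ring m e) (cong (_+_ e) (sym (ℤ.0≤i⇒+∣i∣≡i (ℤ.i≤j⇒0≤j-i e≤m))))
      where ring : ∀ m e → m ≡ e + (m - e)
            ring = solve-∀

  GreedySum⇒AbsLE : ∀ {w} j L → AllDigits a L → GreedyCond a L → w ≡± digitSum a j L → AbsLE a w j
  GreedySum⇒AbsLE j [] _ _ w≡± = inj₁ (reduce w≡±)
  GreedySum⇒AbsLE j (zero ∷ L) (_ , L≤a) greedy w≡± =
    AbsLE-weaken (ℤ.i≤i+j j (+ 1))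
      (GreedySum⇒AbsLE (j + + 1) L L≤a (GreedyCond-tail 0 L greedy) (≡±-trans w≡± (inj₁ (digitSum-0∷ j L))))
  GreedySum⇒AbsLE j (suc c ∷ L) L≤a greedy w≡± =
    inj₂ (j , (suc c , L , (λ ()) , L≤a , greedy , w≡±) , ℤ.≤-refl)

  AbsLE-⊖ : ∀ e {u v} → AbsLE a u e → AbsLE a v e → AbsLE a (u ⊖ v) (e - + 2)
  AbsLE-⊖ e u≤ v≤ with GreedySum-⊖ e (AbsLE⇒GreedySum u≤) (AbsLE⇒GreedySum v≤)
  ... | L , L≤a , greedy , u-v≡± = GreedySum⇒AbsLE (e - + 2) L L≤a greedy u-v≡±

  IsNull-self : ∀ h → IsNull a (subSeq h h)
  IsNull-self h k = 0 , λ i _ → inj₁ (⊖-self (h i))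

  IsCauchy-⊕ : ∀ {f g} → IsCauchy a f → IsCauchy a g → IsCauchy a (λ i → f i ⊕ g i)
  IsCauchy-⊕ {f} {g} f-cauchy g-cauchy k = proj₁ f-close ⊔ proj₁ g-close , close
    where
    f-close = f-cauchy (suc (suc k))
    g-close = g-cauchy (suc (suc k))
    close : ∀ i j → proj₁ f-close ⊔ proj₁ g-close ℕ.≤ i → proj₁ f-close ⊔ proj₁ g-close ℕ.≤ j →
            AbsLE a ((f i ⊕ g i) ⊖ (f j ⊕ g j)) (+ suc k)
    close i j i≥N j≥N = subst (λ w → AbsLE a w (+ suc k)) (sym (⊕-⊖-⊕ (f i) (g i) (f j) (g j)))
      (AbsLE-⊖ (+ suc (suc (suc k)))
        (proj₂ f-close i j (ℕ.m⊔n≤o⇒m≤o _ _ i≥N) (ℕ.m⊔n≤o⇒m≤o _ _ j≥N))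
        (proj₂ g-close j i (ℕ.m⊔n≤o⇒n≤o _ _ j≥N) (ℕ.m⊔n≤o⇒n≤o _ _ i≥N)))

  Represents-⊕ : ∀ {F f g} → IsCauchy a g → Represents a F (subSeq f g) → Represents a (λ i → F i ⊕ g i) f
  Represents-⊕ {F} {f} {g} g-cauchy (F-cauchy , F≈f-g) =
    IsCauchy-⊕ {F} {g} F-cauchy g-cauchy ,
    λ k → proj₁ (F≈f-g k) ,
          λ i i≥N → subst (λ w → AbsLE a w (+ k)) (⊖-⊖ (F i) (f i) (g i)) (proj₂ (F≈f-g k) i i≥N)

-- f need not be Cauchy: ‖f̂‖ ≤ θ^(−e) already speaks about every representative of f̂.
theorem12 : (a : ℕ) → 1 ≤ a → (f g : Seq) → IsCauchy a f → IsCauchy a g →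
    (e : ℤ) → NormLE a f e → NormLE a g e → NormLE a (subSeq f g) (e - + 2)
theorem12 (suc a-1) _ f g _ g-cauchy e ‖f‖≤ ‖g‖≤ F F-represents = Nf ⊔ Ng , bound
  where
  open GreedyExpansions a-1
  f-bound = ‖f‖≤ (λ i → F i ⊕ g i) (Represents-⊕ {F} {f} {g} g-cauchy F-represents)
  g-bound = ‖g‖≤ g (g-cauchy , IsNull-self g)
  Nf = proj₁ f-bound
  Ng = proj₁ g-bound
  bound : ∀ i → Nf ⊔ Ng ℕ.≤ i → AbsLE (suc a-1) (F i) (e - + 2)
  bound i i≥N = subst (λ w → AbsLE (suc a-1) w (e - + 2)) (⊕-⊖-cancel (F i) (g i))
    (AbsLE-⊖ e (proj₂ f-bound i (ℕ.m⊔n≤o⇒m≤o _ _ i≥N)) (proj₂ g-bound i (ℕ.m⊔n≤o⇒n≤o _ _ i≥N)))
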